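{- Let $\Sigma$ be a finite $d$-dimensional CW complex with $r=\operatorname{rank}\partial_d$, and let $\Gamma\subseteq\Upsilon\subseteq\Sigma$ be subcomplexes with $\dim\Upsilon=d$, $\dim\Gamma=d-1$, $|\Upsilon_d|=r$, $|\Gamma_{d-1}|=|\Sigma_{d-1}|-r$, $\Upsilon_{(d-1)}=\Sigma_{(d-1)}$ and $\Gamma_{(d-2)}=\Sigma_{(d-2)}$. Let $R=\Sigma_{d-1}\setminus\Gamma_{d-1}$. Then the following are equivalent: (a) the $r\times r$ matrix $\partial_{R,\Upsilon}$ is nonsingular; (b) $\tilde H_d(\Upsilon,\Gamma;\mathbb{Q})=0$ and $\tilde H_{d-1}(\Upsilon,\Gamma;\mathbb{Q})=0$; (c) $\tilde H_d(\Upsilon,\Gamma;\mathbb{Q})=0$ or $\tilde H_{d-1}(\Upsilon,\Gamma;\mathbb{Q})=0$; (d) $\Upsilon$ is a cellular spanning forest of $\Sigma$ and $\Gamma$ is relatively acyclic.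
   Context: $\Sigma$ has the convention of a unique $(-1)$-cell, so (relative) cellular homology is reduced; $\Sigma_i$ is the set of $i$-cells and $\Sigma_{(i)}$ the $i$-skeleton. Cells are oriented and $\partial_d$ is the matrix of the top cellular boundary map; $\partial_{X,Y}$ is its submatrix with rows indexed by the $(d-1)$-cells $X$ and columns by the $d$-cells $Y$ (here the $d$-cells of $\Upsilon$). A cellular spanning forest of $\Sigma$ is a subcomplex $\Upsilon$ with $\Upsilon_{(d-1)}=\Sigma_{(d-1)}$ whose $d$-cells index a basis of the column space of $\partial_d$ over $\mathbb{R}$. A subcomplex $\Gamma$ of dimension $\le d-1$ with $\Gamma_{(d-2)}=\Sigma_{(d-2)}$ is relatively acyclic if the inclusion induces isomorphisms $\tilde H_k(\Gamma;\mathbb{Q})\to\tilde H_k(\Sigma;\mathbb{Q})$ for all $k<d$. -}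

module Defs where

open import Data.Nat using (ℕ; zero; suc; _≤_; _<_; _∸_)
open import Data.Fin using (Fin; zero; suc)
open import Data.Bool using (Bool; true; false; if_then_else_)
open import Data.Vec using (lookup)
open import Data.Integer as ℤ using (ℤ)
open import Data.Rational as ℚ using (ℚ; 0ℚ; 1ℚ)
open import Data.Fin.Subset using (Subset; _∈_; _⊆_; ∣_∣; ∁; ⊤; ⊥)
open import Data.Product using (Σ; ∃; _×_; _,_)
open import Relation.Binary.PropositionalEquality using (_≡_; _≢_)
open import Relation.Nullary using (¬_)

sumℤ : ∀ n → (Fin n → ℤ) → ℤ
sumℤ zero    f = ℤ.0ℤ
sumℤ (suc n) f = f zero ℤ.+ sumℤ n (λ i → f (suc i))

sumℚ : ∀ n → (Fin n → ℚ) → ℚ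
sumℚ zero    f = 0ℚ
sumℚ (suc n) f = f zero ℚ.+ sumℚ n (λ i → f (suc i))

sumOver : ∀ {n} → Subset n → (Fin n → ℚ) → ℚ
sumOver {n} S f = sumℚ n (λ i → if lookup S i then f i else 0ℚ)

toℚ : ℤ → ℚ
toℚ z = z ℚ./ 1

δ : ∀ {n} → Fin n → Fin n → ℚ
δ i j with i Data.Fin.≟ j
... | Relation.Nullary.yes _ = 1ℚ
... | Relation.Nullary.no  _ = 0ℚ

-- A finite d-dimensional (regular or not) CW complex Σ, recorded
-- through its augmented cellular chain complex (convention: a unique
-- (-1)-cell).  DIMENSIONS ARE SHIFTED BY ONE: index j stands for
-- cellular dimension j - 1.  So  ncells 0 = 1  is the (-1)-cell,
-- ncells (suc k) = number of k-cells, and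
--   bd j : (rows: cells of index j) × (cols: cells of index suc j) → ℤ
-- is the matrix of the cellular boundary map ∂_j : C_j → C_{j-1}
-- (unshifted numbering: columns = j-cells, rows = (j-1)-cells).
-- The top boundary matrix ∂_d is  bd d.

record CWComplex : Set where
  field
    dim    : ℕ
    ncells : ℕ → ℕ
    bd     : (j : ℕ) → Fin (ncells j) → Fin (ncells (suc j)) → ℤ
    unique-1cell : ncells 0 ≡ 1
    finite-dim   : ∀ j → suc (suc dim) ≤ j → ncells j ≡ 0
    augmentation : ∀ a c → bd 0 a c ≡ ℤ.+ 1      -- ∂ (vertex) = the (-1)-cell
    bd∘bd        : ∀ j a c →
                   sumℤ (ncells (suc j)) (λ b → bd j a b ℤ.* bd (suc j) b c) ≡ ℤ.0ℤ

open CWComplex public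

module _ (X : CWComplex) where

  Chain : ℕ → Set
  Chain j = Fin (ncells X j) → ℚ

  ∂ : (j : ℕ) → Chain (suc j) → Chain j
  ∂ j x a = sumℚ (ncells X (suc j)) (λ b → toℚ (bd X j a b) ℚ.* x b)

  SupportedOn : ∀ {j} → Subset (ncells X j) → Chain j → Set
  SupportedOn S x = ∀ i → ¬ (i ∈ S) → x i ≡ 0ℚ

  CellSet : Set
  CellSet = (j : ℕ) → Subset (ncells X j)

  IsSubcomplex : CellSet → Set
  IsSubcomplex A = ∀ j a b → b ∈ A (suc j) → bd X j a b ≢ ℤ.0ℤ → a ∈ A j

  _⊆ᶜ_ : CellSet → CellSet → Set
  A ⊆ᶜ B = ∀ j → A j ⊆ B j

  ChainOf : CellSet → (j : ℕ) → Chain j → Set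
  ChainOf A j x = SupportedOn (A j) x

  IsRelCycle : CellSet → CellSet → (j : ℕ) → Chain j → Set
  IsRelCycle A B zero    x = ChainOf A zero x
  IsRelCycle A B (suc j) x = ChainOf A (suc j) x × ChainOf B j (∂ j x)

  -- H̃_j(A , B ; ℚ) = 0  (shifted index j, i.e. dimension j - 1):
  -- every relative cycle is a relative boundary, x = ∂ y + z with
  -- y a chain of A and z a chain of B.
  RelHomologyVanishes : CellSet → CellSet → ℕ → Set
  RelHomologyVanishes A B j =
    ∀ x → IsRelCycle A B j x →
      Σ (Chain (suc j)) λ y → Σ (Chain j) λ z →
        ChainOf A (suc j) y × ChainOf B j z × (∀ i → x i ≡ ∂ j y i ℚ.+ z i)

  -- absolute cycles of A (reduced, thanks to the (-1)-cell)
  IsCycle : CellSet → (j : ℕ) → Chain j → Set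
  IsCycle A j x = IsRelCycle A (λ k → ⊥) j x

  -- the map H̃_j(A;ℚ) → H̃_j(X;ℚ) induced by inclusion is injective
  InclInjective : CellSet → ℕ → Set
  InclInjective A j =
    ∀ x → IsCycle A j x →
      (Σ (Chain (suc j)) λ y → ∀ i → x i ≡ ∂ j y i) →
      Σ (Chain (suc j)) λ y → ChainOf A (suc j) y × (∀ i → x i ≡ ∂ j y i)

  -- ... and surjective
  InclSurjective : CellSet → ℕ → Set
  InclSurjective A j =
    ∀ x → IsCycle (λ k → ⊤) j x →
      Σ (Chain j) λ x' → Σ (Chain (suc j)) λ y →
        IsCycle A j x' × (∀ i → x i ≡ x' i ℚ.+ ∂ j y i)

  Matrix : ℕ → ℕ → Set
  Matrix m n = Fin m → Fin n → ℚ

  topMatrix : Matrix (ncells X (dim X)) (ncells X (suc (dim X)))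
  topMatrix a b = toℚ (bd X (dim X) a b)

  ColsIndependent : ∀ {m n} → Matrix m n → Subset n → Set
  ColsIndependent {m} {n} M S =
    ∀ (c : Fin n → ℚ) → (∀ i → ¬ (i ∈ S) → c i ≡ 0ℚ) →
      (∀ a → sumℚ n (λ b → M a b ℚ.* c b) ≡ 0ℚ) → ∀ i → c i ≡ 0ℚ

  HasRank : ∀ {m n} → Matrix m n → ℕ → Set
  HasRank {m} {n} M r =
    (Σ (Subset n) λ S → ∣ S ∣ ≡ r × ColsIndependent M S) ×
    (∀ (S : Subset n) → ∣ S ∣ ≡ suc r → ¬ ColsIndependent M S)

  ColsBasis : ∀ {m n} → Matrix m n → Subset n → Set
  ColsBasis {m} {n} M S =
    ColsIndependent M S ×
    (∀ b → Σ (Fin n → ℚ) λ c → (∀ i → ¬ (i ∈ S) → c i ≡ 0ℚ) ×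
                       (∀ a → M a b ≡ sumℚ n (λ b' → M a b' ℚ.* c b')))

  NonsingularSub : ∀ {m n} → Matrix m n → Subset m → Subset n → Set
  NonsingularSub {m} {n} M R U =
    Σ (Fin n → Fin m → ℚ) λ N →
      (∀ i i' → i ∈ U → i' ∈ U → sumOver R (λ k → N i k ℚ.* M k i') ≡ δ i i') ×
      (∀ k k' → k ∈ R → k' ∈ R → sumOver U (λ i → M k i ℚ.* N i k') ≡ δ k k')

  IsCellularSpanningForest : CellSet → Set
  IsCellularSpanningForest Υ =
    IsSubcomplex Υ ×
    (∀ j → j ≤ dim X → Υ j ≡ ⊤) ×                 -- Υ_(d-1) = Σ_(d-1)
    ColsBasis topMatrix (Υ (suc (dim X)))

  IsRelativelyAcyclic : CellSet → Set
  IsRelativelyAcyclic Γ =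
    IsSubcomplex Γ ×
    (∀ j → suc (dim X) ≤ j → Γ j ≡ ⊥) ×          -- dim Γ ≤ d-1
    (∀ j → j < dim X → Γ j ≡ ⊤) ×                 -- Γ_(d-2) = Σ_(d-2)
    (∀ j → j ≤ dim X →                            -- all dimensions k = j-1 < d
       InclInjective Γ j × InclSurjective Γ j)

-- Since Σ has no (d+1)-cells and Γ no d-cells, H̃_d(Υ,Γ) is the kernel of the map
-- ℚ^{Υ_d} → ℚ^R given by ∂_{R,Υ}; since Υ and Γ contain the (d-1)- and (d-2)-skeleton, every
-- (d-1)-chain is a relative cycle and H̃_{d-1}(Υ,Γ) is the cokernel of the same map.  As
-- |R| = r = |Υ_d| the matrix is square, and by Gaussian elimination a square matrix is
-- injective iff surjective iff invertible: this gives (a) ⇔ (b) ⇔ (c).  If ∂_{R,Υ} is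
-- nonsingular, the r columns of Υ are independent, hence a basis of the column space of ∂_d,
-- and the vanishing of both relative homology groups makes Γ → Σ a homology isomorphism.
-- Conversely, if x is a chain on Υ_d with ∂x supported on Γ, the cycle ∂x of Γ bounds in Σ,
-- hence in Γ, which has no d-cells; so ∂x = 0, and x = 0 as the columns of Υ are independent.

module Submission where

open import Defs
open import Data.Nat using (ℕ; zero; suc; _≤_; _<_; _∸_; s≤s)
import Data.Nat.Properties as ℕ
open import Data.Fin using (Fin; zero; suc)
import Data.Fin.Properties as Fin
open import Data.Bool using (true; false; if_then_else_)
open import Data.Vec using ([]; _∷_; here; there; lookup)
import Data.Vec.Properties as Vec
open import Data.Integer as ℤ using (ℤ)
import Data.Integer.Properties as ℤ
open import Data.Rational using (ℚ; 0ℚ; 1ℚ; _+_; _*_; -_; _-_; 1/_; mkℚ; NonZero; ≢-nonZero)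
import Data.Rational.Properties as ℚ
open import Data.Rational.Solver using (module +-*-Solver)
open +-*-Solver
import Data.Nat.Coprimality as Coprimality
open import Algebra.Bundles using (Ring)
open import Algebra.Properties.Semiring.Sum (Ring.semiring ℚ.+-*-ring)
  using (sum; sum-cong-≗; sum-replicate-zero; ∑-distrib-+; ∑-comm; *-distribˡ-sum)
open import Data.Fin.Subset
  using (Subset; _∈_; _∉_; ∣_∣; ∁; ⊤; ⊥; inside; outside; _∪_; ⁅_⁆; Nonempty) renaming (_-_ to _∖_)
open import Data.Fin.Subset.Properties
  using (_∈?_; ∈⊤; ∉⊥; ∣⊥∣≡0; ∣⊤∣≡n; ∣∁p∣≡n∸∣p∣; x∉p⇒x∈∁p; x∈∁p⇒x∉p; p─q⊆p; p─⊥≡p; ∪-identityʳ;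
         drop-there; x∈p∪q⁻; x∈⁅y⁆⇒x≡y; nonempty?; Empty-unique)
open import Data.Product using (∃; _×_; _,_; proj₁; proj₂)
open import Data.Sum using (_⊎_; inj₁; inj₂; [_,_]′)
open import Data.Empty using (⊥-elim)
open import Function using (_∘_; _⇔_; mk⇔; Equivalence)
open import Function.Construct.Composition using (_⇔-∘_)
open import Function.Construct.Symmetry using (⇔-sym)
open import Relation.Binary.PropositionalEquality
open import Relation.Nullary using (yes; no)
open import Relation.Nullary.Decidable using (_×-dec_; ¬?)

sumℚ≡sum : ∀ n (f : Fin n → ℚ) → sumℚ n f ≡ sum f
sumℚ≡sum zero    f = refl
sumℚ≡sum (suc n) f = cong (f zero +_) (sumℚ≡sum n (λ i → f (suc i)))

sumℚ-cong : ∀ n {f g : Fin n → ℚ} → (∀ i → f i ≡ g i) → sumℚ n f ≡ sumℚ n g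
sumℚ-cong n {f} {g} f≗g = begin
  sumℚ n f ≡⟨ sumℚ≡sum n f ⟩
  sum f    ≡⟨ sum-cong-≗ f≗g ⟩
  sum g    ≡⟨ sumℚ≡sum n g ⟨
  sumℚ n g ∎
  where open ≡-Reasoning

sumℚ-zero : ∀ n {f : Fin n → ℚ} → (∀ i → f i ≡ 0ℚ) → sumℚ n f ≡ 0ℚ
sumℚ-zero n f≗0 = trans (sumℚ-cong n f≗0) (trans (sumℚ≡sum n _) (sum-replicate-zero n))

sumℚ-+ : ∀ n (f g : Fin n → ℚ) → sumℚ n (λ i → f i + g i) ≡ sumℚ n f + sumℚ n g
sumℚ-+ n f g = begin
  sumℚ n (λ i → f i + g i) ≡⟨ sumℚ≡sum n _ ⟩
  sum (λ i → f i + g i)    ≡⟨ ∑-distrib-+ f g ⟩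
  sum f + sum g            ≡⟨ cong₂ _+_ (sumℚ≡sum n f) (sumℚ≡sum n g) ⟨
  sumℚ n f + sumℚ n g      ∎
  where open ≡-Reasoning

sumℚ-*ˡ : ∀ n a (f : Fin n → ℚ) → sumℚ n (λ i → a * f i) ≡ a * sumℚ n f
sumℚ-*ˡ n a f = begin
  sumℚ n (λ i → a * f i) ≡⟨ sumℚ≡sum n _ ⟩
  sum (λ i → a * f i)    ≡⟨ *-distribˡ-sum a f ⟨
  a * sum f              ≡⟨ cong (a *_) (sumℚ≡sum n f) ⟨
  a * sumℚ n f           ∎
  where open ≡-Reasoning

sumℚ-*ʳ : ∀ n a (f : Fin n → ℚ) → sumℚ n (λ i → f i * a) ≡ sumℚ n f * a
sumℚ-*ʳ n a f = trans (sumℚ-cong n (λ i → ℚ.*-comm (f i) a)) (trans (sumℚ-*ˡ n a f) (ℚ.*-comm a _))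

sumℚ-neg : ∀ n (f : Fin n → ℚ) → sumℚ n (λ i → - f i) ≡ - sumℚ n f
sumℚ-neg zero    f = refl
sumℚ-neg (suc n) f =
  trans (cong (- f zero +_) (sumℚ-neg n (λ i → f (suc i)))) (sym (ℚ.neg-distrib-+ (f zero) _))

sumℚ-- : ∀ n (f g : Fin n → ℚ) → sumℚ n (λ i → f i - g i) ≡ sumℚ n f - sumℚ n g
sumℚ-- n f g = trans (sumℚ-+ n f (λ i → - g i)) (cong (sumℚ n f +_) (sumℚ-neg n g))

sumℚ-comm : ∀ m n (f : Fin m → Fin n → ℚ) →
            sumℚ m (λ i → sumℚ n (f i)) ≡ sumℚ n (λ j → sumℚ m (λ i → f i j))
sumℚ-comm m n f = begin
  sumℚ m (λ i → sumℚ n (f i))         ≡⟨ sumℚ-cong m (λ i → sumℚ≡sum n (f i)) ⟩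
  sumℚ m (λ i → sum (f i))            ≡⟨ sumℚ≡sum m _ ⟩
  sum (λ i → sum (f i))               ≡⟨ ∑-comm f ⟩
  sum (λ j → sum (λ i → f i j))       ≡⟨ sumℚ≡sum n _ ⟨
  sumℚ n (λ j → sum (λ i → f i j))    ≡⟨ sumℚ-cong n (λ j → sumℚ≡sum m (λ i → f i j)) ⟨
  sumℚ n (λ j → sumℚ m (λ i → f i j)) ∎
  where open ≡-Reasoning

δ-refl : ∀ {n} (i : Fin n) → δ i i ≡ 1ℚ
δ-refl i with i Fin.≟ i
... | yes _  = refl
... | no i≢i = ⊥-elim (i≢i refl)

δ-≢ : ∀ {n} {i j : Fin n} → i ≢ j → δ i j ≡ 0ℚ
δ-≢ {i = i} {j} i≢j with i Fin.≟ j
... | yes i≡j = ⊥-elim (i≢j i≡j)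
... | no _    = refl

δ-sym : ∀ {n} (i j : Fin n) → δ i j ≡ δ j i
δ-sym i j with i Fin.≟ j
... | yes refl = sym (δ-refl i)
... | no i≢j   = sym (δ-≢ (i≢j ∘ sym))

sumℚ-single : ∀ n (f : Fin n → ℚ) i → (∀ j → j ≢ i → f j ≡ 0ℚ) → sumℚ n f ≡ f i
sumℚ-single (suc n) f zero    f≗0 =
  trans (cong (f zero +_) (sumℚ-zero n (λ j → f≗0 (suc j) (λ ())))) (ℚ.+-identityʳ (f zero))
sumℚ-single (suc n) f (suc i) f≗0 =
  trans (cong₂ _+_ (f≗0 zero (λ ())) (sumℚ-single n (λ j → f (suc j)) i (λ j j≢i → f≗0 (suc j) (j≢i ∘ Fin.suc-injective))))
        (ℚ.+-identityˡ _)

sumℚ-δˡ : ∀ n i (f : Fin n → ℚ) → sumℚ n (λ j → δ i j * f j) ≡ f i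
sumℚ-δˡ n i f =
  trans (sumℚ-single n _ i (λ j j≢i → trans (cong (_* f j) (δ-≢ (λ i≡j → j≢i (sym i≡j)))) (ℚ.*-zeroˡ (f j))))
        (trans (cong (_* f i) (δ-refl i)) (ℚ.*-identityˡ (f i)))

sumℚ-δʳ : ∀ n i (f : Fin n → ℚ) → sumℚ n (λ j → f j * δ j i) ≡ f i
sumℚ-δʳ n i f = trans (sumℚ-cong n (λ j → trans (ℚ.*-comm (f j) _) (cong (_* f j) (δ-sym j i)))) (sumℚ-δˡ n i f)

toℚ≡mkℚ : ∀ z → toℚ z ≡ mkℚ z 0 (Coprimality.sym (Coprimality.1-coprimeTo _))
toℚ≡mkℚ (ℤ.+ n)    = ℚ.normalize-coprime {n} {0} _
toℚ≡mkℚ ℤ.-[1+ n ] = cong -_ (ℚ.normalize-coprime {suc n} {0} _)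

toℚ-+ : ∀ a b → toℚ (a ℤ.+ b) ≡ toℚ a + toℚ b
toℚ-+ a b rewrite toℚ≡mkℚ a | toℚ≡mkℚ b =
  sym (cong toℚ (cong₂ ℤ._+_ (ℤ.*-identityʳ a) (ℤ.*-identityʳ b)))

toℚ-* : ∀ a b → toℚ (a ℤ.* b) ≡ toℚ a * toℚ b
toℚ-* a b rewrite toℚ≡mkℚ a | toℚ≡mkℚ b = refl

toℚ-sum : ∀ n (f : Fin n → ℤ) → toℚ (sumℤ n f) ≡ sumℚ n (λ i → toℚ (f i))
toℚ-sum zero    f = refl
toℚ-sum (suc n) f = trans (toℚ-+ (f zero) _) (cong (toℚ (f zero) +_) (toℚ-sum n (λ i → f (suc i))))

sumℚ-empty : ∀ {n} → n ≡ 0 → (f : Fin n → ℚ) → sumℚ n f ≡ 0ℚ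
sumℚ-empty refl f = refl

∉⇒lookup≡false : ∀ {n} (p : Subset n) x → x ∉ p → lookup p x ≡ false
∉⇒lookup≡false p x x∉p with lookup p x in eq
... | true  = ⊥-elim (x∉p (Vec.lookup⇒[]= x p eq))
... | false = refl

x∉p∖x : ∀ {n} (p : Subset n) x → x ∉ p ∖ x
x∉p∖x (_ ∷ p) zero    ()
x∉p∖x (_ ∷ p) (suc x) (there x∈p-x) = x∉p∖x p x x∈p-x

∣p∣≡1+∣p∖x∣ : ∀ {n} {p : Subset n} {x} → x ∈ p → ∣ p ∣ ≡ suc ∣ p ∖ x ∣
∣p∣≡1+∣p∖x∣ {p = inside ∷ p} here = cong suc (cong ∣_∣ (sym (p─⊥≡p p)))
∣p∣≡1+∣p∖x∣ {p = inside  ∷ p} (there x∈p) = cong suc (∣p∣≡1+∣p∖x∣ x∈p)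
∣p∣≡1+∣p∖x∣ {p = outside ∷ p} (there x∈p) = ∣p∣≡1+∣p∖x∣ x∈p

∣p∪⁅x⁆∣≡1+∣p∣ : ∀ {n} {x : Fin n} {p : Subset n} → x ∉ p → ∣ p ∪ ⁅ x ⁆ ∣ ≡ suc ∣ p ∣
∣p∪⁅x⁆∣≡1+∣p∣ {x = zero} {p = inside ∷ p} x∉p = ⊥-elim (x∉p here)
∣p∪⁅x⁆∣≡1+∣p∣ {x = zero} {p = outside ∷ p} x∉p = cong suc (cong ∣_∣ (∪-identityʳ p))
∣p∪⁅x⁆∣≡1+∣p∣ {x = suc x} {p = inside ∷ p} x∉p = cong suc (∣p∪⁅x⁆∣≡1+∣p∣ (x∉p ∘ there))
∣p∪⁅x⁆∣≡1+∣p∣ {x = suc x} {p = outside ∷ p} x∉p = ∣p∪⁅x⁆∣≡1+∣p∣ (x∉p ∘ there)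

0<∣p∣⇒nonempty : ∀ {n} {p : Subset n} → 0 < ∣ p ∣ → Nonempty p
0<∣p∣⇒nonempty {n = n} {p = p} 0<∣p∣ with nonempty? p
... | yes p≢∅ = p≢∅
... | no  p≡∅ = ⊥-elim (ℕ.<-irrefl (sym (trans (cong ∣_∣ (Empty-unique p≡∅)) (∣⊥∣≡0 n))) 0<∣p∣)

Supported : ∀ {n} → Subset n → (Fin n → ℚ) → Set
Supported S x = ∀ i → i ∉ S → x i ≡ 0ℚ

δ-supported : ∀ {n} {S : Subset n} {s} → s ∈ S → Supported S (δ s)
δ-supported s∈S i i∉S = δ-≢ (λ s≡i → i∉S (subst (_∈ _) s≡i s∈S))

infixr 7 _·ᵥ_
_·ᵥ_ : ∀ {m n} → (Fin m → Fin n → ℚ) → (Fin n → ℚ) → Fin m → ℚ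
_·ᵥ_ {n = n} M x k = sumℚ n (λ b → M k b * x b)

module _ {m n} (M : Fin m → Fin n → ℚ) where

  ·ᵥ-cong : ∀ {x y} → (∀ b → x b ≡ y b) → ∀ k → (M ·ᵥ x) k ≡ (M ·ᵥ y) k
  ·ᵥ-cong x≗y k = sumℚ-cong n (λ b → cong (M k b *_) (x≗y b))

  ·ᵥ-zero : ∀ {x} → (∀ b → x b ≡ 0ℚ) → ∀ k → (M ·ᵥ x) k ≡ 0ℚ
  ·ᵥ-zero x≗0 k = sumℚ-zero n (λ b → trans (cong (M k b *_) (x≗0 b)) (ℚ.*-zeroʳ (M k b)))

  ·ᵥ-+ : ∀ x y k → (M ·ᵥ (λ b → x b + y b)) k ≡ (M ·ᵥ x) k + (M ·ᵥ y) k
  ·ᵥ-+ x y k = trans (sumℚ-cong n (λ b → ℚ.*-distribˡ-+ (M k b) (x b) (y b))) (sumℚ-+ n _ _)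

  ·ᵥ-- : ∀ x y k → (M ·ᵥ (λ b → x b - y b)) k ≡ (M ·ᵥ x) k - (M ·ᵥ y) k
  ·ᵥ-- x y k = trans (sumℚ-cong n (λ b → solve 3 (λ a u v → a :* (u :- v) := a :* u :- a :* v) refl (M k b) (x b) (y b)))
                     (sumℚ-- n _ _)

  ·ᵥ-* : ∀ a x k → (M ·ᵥ (λ b → a * x b)) k ≡ a * (M ·ᵥ x) k
  ·ᵥ-* a x k = trans (sumℚ-cong n (λ b → solve 3 (λ u a v → u :* (a :* v) := a :* (u :* v)) refl (M k b) a (x b)))
                     (sumℚ-*ˡ n a _)

  ·ᵥ-δ : ∀ s k → (M ·ᵥ δ s) k ≡ M k s
  ·ᵥ-δ s k = trans (sumℚ-cong n (λ b → cong (M k b *_) (δ-sym s b))) (sumℚ-δʳ n s (M k))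

  IsKernelVector : Subset n → Subset m → (Fin n → ℚ) → Set
  IsKernelVector S T x = Supported S x × (∀ k → k ∈ T → (M ·ᵥ x) k ≡ 0ℚ)

  NonzeroKernelVector : Subset n → Subset m → Set
  NonzeroKernelVector S T = ∃ λ x → IsKernelVector S T x × ∃ λ i → x i ≢ 0ℚ

  InjectiveOn : Subset n → Subset m → Set
  InjectiveOn S T = ∀ x → IsKernelVector S T x → ∀ i → x i ≡ 0ℚ

  SurjectiveOn : Subset n → Subset m → Set
  SurjectiveOn S T = ∀ (y : Fin m → ℚ) → ∃ λ x → Supported S x × (∀ k → k ∈ T → (M ·ᵥ x) k ≡ y k)

·ᵥ-·ᵥ : ∀ {m n p} (M : Fin m → Fin n → ℚ) (N : Fin n → Fin p → ℚ) w k →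
        (M ·ᵥ (N ·ᵥ w)) k ≡ sumℚ p (λ j → (M ·ᵥ (λ i → N i j)) k * w j)
·ᵥ-·ᵥ {n = n} {p} M N w k = begin
  sumℚ n (λ i → M k i * sumℚ p (λ j → N i j * w j))   ≡⟨ sumℚ-cong n (λ i → sumℚ-*ˡ p (M k i) _) ⟨
  sumℚ n (λ i → sumℚ p (λ j → M k i * (N i j * w j))) ≡⟨ sumℚ-comm n p _ ⟩
  sumℚ p (λ j → sumℚ n (λ i → M k i * (N i j * w j))) ≡⟨ sumℚ-cong p (λ j → trans
                                                            (sumℚ-cong n (λ i → sym (ℚ.*-assoc (M k i) (N i j) (w j))))
                                                            (sumℚ-*ʳ n (w j) _)) ⟩
  sumℚ p (λ j → (M ·ᵥ (λ i → N i j)) k * w j)         ∎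
  where open ≡-Reasoning

kernelVector-∷ : ∀ {m n} (M : Fin (suc m) → Fin n → ℚ) {S T t x} →
                 IsKernelVector (M ∘ suc) S T x → (t ≡ inside → (M ·ᵥ x) zero ≡ 0ℚ) →
                 IsKernelVector M S (t ∷ T) x
kernelVector-∷ M (x-supp , x-rows) row₀ = x-supp , λ where
  zero    here        → row₀ refl
  (suc k) (there k∈T) → x-rows k k∈T

module _ {m n} (M : Fin (suc m) → Fin n → ℚ) {s} (pivot≢0 : M zero s ≢ 0ℚ) where

  private instance
    pivot-nonZero : NonZero (M zero s)
    pivot-nonZero = ≢-nonZero pivot≢0

  clearColumn : Fin m → Fin n → ℚ
  clearColumn k b = M (suc k) b - (M (suc k) s * 1/ M zero s) * M zero b

  clearColumn-·ᵥ : ∀ x k → (clearColumn ·ᵥ x) k ≡ (M ·ᵥ x) (suc k) - (M (suc k) s * 1/ M zero s) * (M ·ᵥ x) zero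
  clearColumn-·ᵥ x k = trans
    (sumℚ-cong n (λ b → solve 4 (λ u c v y → (u :- c :* v) :* y := u :* y :- c :* (v :* y)) refl
                         (M (suc k) b) (M (suc k) s * 1/ M zero s) (M zero b) (x b)))
    (trans (sumℚ-- n _ _) (cong (λ t → (M ·ᵥ x) (suc k) - t) (sumℚ-*ˡ n (M (suc k) s * 1/ M zero s) (λ b → M zero b * x b))))

  kernelVector-lift : ∀ {S T} → s ∈ S → NonzeroKernelVector clearColumn (S ∖ s) T →
                      NonzeroKernelVector M S (inside ∷ T)
  kernelVector-lift {S} {T} s∈S (x , (x-supp , x-rows) , i , xᵢ≢0) =
    y , kernelVector-∷ M (y-supp , λ k k∈T → trans (M·y (suc k)) (trans (row-suc k) (x-rows k k∈T))) (λ _ → row₀) , i , yᵢ≢0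
    where
    a : ℚ
    a = (M ·ᵥ x) zero * 1/ M zero s
    y : Fin n → ℚ
    y b = x b - a * δ s b
    M·y : ∀ k → (M ·ᵥ y) k ≡ (M ·ᵥ x) k - a * M k s
    M·y k = trans (·ᵥ-- M x _ k) (cong (λ t → (M ·ᵥ x) k - t) (trans (·ᵥ-* M a (δ s) k) (cong (a *_) (·ᵥ-δ M s k))))
    row₀ : (M ·ᵥ y) zero ≡ 0ℚ
    row₀ = trans (M·y zero) (trans
      (solve 3 (λ l i p → l :- (l :* i) :* p := l :- l :* (i :* p)) refl ((M ·ᵥ x) zero) (1/ M zero s) (M zero s))
      (trans (cong (λ t → (M ·ᵥ x) zero - (M ·ᵥ x) zero * t) (ℚ.*-inverseˡ (M zero s)))
             (solve 1 (λ l → l :- l :* con 1ℚ := con 0ℚ) refl ((M ·ᵥ x) zero))))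
    row-suc : ∀ k → (M ·ᵥ x) (suc k) - a * M (suc k) s ≡ (clearColumn ·ᵥ x) k
    row-suc k = trans
      (solve 4 (λ u l i c → u :- (l :* i) :* c := u :- (c :* i) :* l) refl
             ((M ·ᵥ x) (suc k)) ((M ·ᵥ x) zero) (1/ M zero s) (M (suc k) s))
      (sym (clearColumn-·ᵥ x k))
    y-supp : Supported S y
    y-supp j j∉S = trans (cong₂ (λ u v → u - a * v) (x-supp j (j∉S ∘ p─q⊆p S _))
                                                    (δ-≢ (λ s≡j → j∉S (subst (_∈ S) s≡j s∈S))))
                         (solve 1 (λ a → con 0ℚ :- a :* con 0ℚ := con 0ℚ) refl a)
    yᵢ≢0 : y i ≢ 0ℚ
    yᵢ≢0 yᵢ≡0 = xᵢ≢0 (trans (solve 2 (λ u a → u := u :- a :* con 0ℚ) refl (x i) a)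
                     (trans (cong (λ t → x i - a * t) (sym (δ-≢ s≢i))) yᵢ≡0))
      where
      s≢i : s ≢ i
      s≢i refl = xᵢ≢0 (x-supp s (x∉p∖x S s))

-- Gaussian elimination: a row of T with a nonzero entry in a column s ∈ S serves as pivot to
-- clear column s, which costs one row and one column.
nonzeroKernelVector : ∀ {m n} (M : Fin m → Fin n → ℚ) S T → ∣ T ∣ < ∣ S ∣ → NonzeroKernelVector M S T
nonzeroKernelVector {zero} M S [] 0<∣S∣ with 0<∣p∣⇒nonempty 0<∣S∣
... | s , s∈S = δ s , (δ-supported s∈S , λ _ ()) , s , λ δss≡0 → ℚ.1≢0 (trans (sym (δ-refl s)) δss≡0)
nonzeroKernelVector {suc m} M S (outside ∷ T) ∣T∣<∣S∣ with nonzeroKernelVector (M ∘ suc) S T ∣T∣<∣S∣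
... | x , x-ker , x≢0 = x , kernelVector-∷ M x-ker (λ ()) , x≢0
nonzeroKernelVector {suc m} {n} M S (inside ∷ T) ∣T∣<∣S∣
  with Fin.any? (λ s → s ∈? S ×-dec ¬? (M zero s ℚ.≟ 0ℚ))
... | yes (s , s∈S , pivot≢0) =
  kernelVector-lift M pivot≢0 s∈S (nonzeroKernelVector (clearColumn M pivot≢0) (S ∖ s) T
    (ℕ.≤-pred (subst (suc (suc ∣ T ∣) ≤_) (∣p∣≡1+∣p∖x∣ s∈S) ∣T∣<∣S∣)))
... | no no-pivot with nonzeroKernelVector (M ∘ suc) S T (ℕ.<-trans (ℕ.n<1+n _) ∣T∣<∣S∣)
...   | x , (x-supp , x-rows) , x≢0 = x , kernelVector-∷ M (x-supp , x-rows) (λ _ → sumℚ-zero n row₀-term) , x≢0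
  where
  row₀-term : ∀ b → M zero b * x b ≡ 0ℚ
  row₀-term b with b ∈? S | M zero b ℚ.≟ 0ℚ
  ... | no b∉S | _       = trans (cong (M zero b *_) (x-supp b b∉S)) (ℚ.*-zeroʳ (M zero b))
  ... | yes _  | yes M≡0 = trans (cong (_* x b) M≡0) (ℚ.*-zeroˡ (x b))
  ... | yes b∈S | no M≢0 = ⊥-elim (no-pivot (b , b∈S , M≢0))

prependColumn : ∀ {m n} → (Fin m → ℚ) → (Fin m → Fin n → ℚ) → Fin m → Fin (suc n) → ℚ
prependColumn y M k zero    = y k
prependColumn y M k (suc b) = M k b

-- A nonzero kernel vector of [y | M] either has a nonzero first entry, and then solves M x = y,
-- or it is a kernel vector of M.
injective⇒surjective : ∀ {m n} (M : Fin m → Fin n → ℚ) {S T} → ∣ T ∣ ≤ ∣ S ∣ →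
                       InjectiveOn M S T → SurjectiveOn M S T
injective⇒surjective M {S} {T} ∣T∣≤∣S∣ inj y
  with nonzeroKernelVector (prependColumn y M) (inside ∷ S) T (s≤s ∣T∣≤∣S∣)
... | c , (c-supp , c-rows) , i , cᵢ≢0 with c zero ℚ.≟ 0ℚ
... | yes c₀≡0 = ⊥-elim (cᵢ≢0 (c≡0 i))
  where
  tail-kernel : IsKernelVector M S T (c ∘ suc)
  tail-kernel = (λ b b∉S → c-supp (suc b) (b∉S ∘ drop-there)) , λ k k∈T → trans
    (solve 2 (λ u t → t := u :* con 0ℚ :+ t) refl (y k) ((M ·ᵥ (c ∘ suc)) k))
    (trans (cong (λ t → y k * t + (M ·ᵥ (c ∘ suc)) k) (sym c₀≡0)) (c-rows k k∈T))
  c≡0 : ∀ i → c i ≡ 0ℚ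
  c≡0 zero    = c₀≡0
  c≡0 (suc b) = inj (c ∘ suc) tail-kernel b
... | no c₀≢0 = x , x-supp , x-rows
  where
  instance
    c₀-nonZero : NonZero (c zero)
    c₀-nonZero = ≢-nonZero c₀≢0
  x : Fin _ → ℚ
  x b = - 1/ c zero * c (suc b)
  x-supp : Supported S x
  x-supp b b∉S = trans (cong (- 1/ c zero *_) (c-supp (suc b) (b∉S ∘ drop-there))) (ℚ.*-zeroʳ (- 1/ c zero))
  x-rows : ∀ k → k ∈ T → (M ·ᵥ x) k ≡ y k
  x-rows k k∈T = begin
    (M ·ᵥ x) k                                                   ≡⟨ ·ᵥ-* M (- 1/ c zero) (c ∘ suc) k ⟩
    - 1/ c zero * t                                              ≡⟨ solve 4 (λ i u c t → (:- i) :* t := (:- i) :* (u :* c :+ t) :+ u :* (c :* i))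
                                                                      refl (1/ c zero) (y k) (c zero) t ⟩
    - 1/ c zero * (y k * c zero + t) + y k * (c zero * 1/ c zero) ≡⟨ cong₂ (λ u v → - 1/ c zero * u + y k * v)
                                                                      (c-rows k k∈T) (ℚ.*-inverseʳ (c zero)) ⟩
    - 1/ c zero * 0ℚ + y k * 1ℚ                                  ≡⟨ solve 2 (λ i u → (:- i) :* con 0ℚ :+ u :* con 1ℚ := u)
                                                                      refl (1/ c zero) (y k) ⟩
    y k                                                          ∎
    where
    open ≡-Reasoning
    t : ℚ
    t = (M ·ᵥ (c ∘ suc)) k

module _ {m n} (M : Fin m → Fin n → ℚ) {S T} (surj : SurjectiveOn M S T) where

  preimages : Fin n → Fin m → ℚ
  preimages i k = proj₁ (surj (δ k)) i

  preimages-supported : ∀ k → Supported S (λ i → preimages i k)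
  preimages-supported k = proj₁ (proj₂ (surj (δ k)))

  M·preimages : ∀ k k' → k' ∈ T → (M ·ᵥ (λ i → preimages i k)) k' ≡ δ k k'
  M·preimages k = proj₂ (proj₂ (surj (δ k)))

  preimages·ᵥ-supported : ∀ w → Supported S (preimages ·ᵥ w)
  preimages·ᵥ-supported w i i∉S =
    sumℚ-zero m (λ k → trans (cong (_* w k) (preimages-supported k i i∉S)) (ℚ.*-zeroˡ (w k)))

  M·preimages·ᵥ : ∀ w → Supported T w → ∀ k → k ∈ T → (M ·ᵥ (preimages ·ᵥ w)) k ≡ w k
  M·preimages·ᵥ w w-supp k k∈T = trans (·ᵥ-·ᵥ M preimages w k) (trans (sumℚ-cong m term) (sumℚ-δʳ m k w))
    where
    term : ∀ k' → (M ·ᵥ (λ i → preimages i k')) k * w k' ≡ w k' * δ k' k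
    term k' with k' ∈? T
    ... | yes k'∈T = trans (cong (_* w k') (M·preimages k' k k∈T)) (ℚ.*-comm (δ k' k) (w k'))
    ... | no k'∉T  = trans (cong (t *_) (w-supp k' k'∉T))
                           (trans (ℚ.*-zeroʳ t) (sym (trans (cong (_* δ k' k) (w-supp k' k'∉T)) (ℚ.*-zeroˡ (δ k' k)))))
      where
      t : ℚ
      t = (M ·ᵥ (λ i → preimages i k')) k

-- For ∣ S ∣ ≤ ∣ T ∣ the injective map Q = preimages is also onto, so every x supported on S
-- is Q w, and then w = M Q w = M x.
surjective⇒injective : ∀ {m n} (M : Fin m → Fin n → ℚ) {S T} → ∣ S ∣ ≤ ∣ T ∣ →
                       SurjectiveOn M S T → InjectiveOn M S T
surjective⇒injective {m} {n} M {S} {T} ∣S∣≤∣T∣ surj x (x-supp , x-rows) i = trans (x≡Qw i) (·ᵥ-zero Q w≡0 i)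
  where
  Q : Fin n → Fin m → ℚ
  Q = preimages M surj
  Q-injective : InjectiveOn Q T S
  Q-injective v (v-supp , v-rows) k with k ∈? T
  ... | no k∉T  = v-supp k k∉T
  ... | yes k∈T = trans (sym (M·preimages·ᵥ M surj v v-supp k k∈T)) (·ᵥ-zero M Qv≡0 k)
    where
    Qv≡0 : ∀ i → (Q ·ᵥ v) i ≡ 0ℚ
    Qv≡0 i with i ∈? S
    ... | yes i∈S = v-rows i i∈S
    ... | no i∉S  = preimages·ᵥ-supported M surj v i i∉S
  preimage : ∃ λ w → Supported T w × (∀ i → i ∈ S → (Q ·ᵥ w) i ≡ x i)
  preimage = injective⇒surjective Q ∣S∣≤∣T∣ Q-injective x
  w : Fin m → ℚ
  w = proj₁ preimage
  w-supp : Supported T w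
  w-supp = proj₁ (proj₂ preimage)
  x≡Qw : ∀ i → x i ≡ (Q ·ᵥ w) i
  x≡Qw i with i ∈? S
  ... | yes i∈S = sym (proj₂ (proj₂ preimage) i i∈S)
  ... | no i∉S  = trans (x-supp i i∉S) (sym (preimages·ᵥ-supported M surj w i i∉S))
  w≡0 : ∀ k → w k ≡ 0ℚ
  w≡0 k with k ∈? T
  ... | no k∉T  = w-supp k k∉T
  ... | yes k∈T = trans (sym (M·preimages·ᵥ M surj w w-supp k k∈T))
                        (trans (·ᵥ-cong M (λ i → sym (x≡Qw i)) k) (x-rows k k∈T))

masked : ∀ {n} → Subset n → (Fin n → ℚ) → Fin n → ℚ
masked S f i = if lookup S i then f i else 0ℚ

module _ {n} (S : Subset n) where

  masked-∈ : ∀ f {i} → i ∈ S → masked S f i ≡ f i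
  masked-∈ f i∈S rewrite Vec.[]=⇒lookup i∈S = refl

  masked-∉ : ∀ f {i} → i ∉ S → masked S f i ≡ 0ℚ
  masked-∉ f {i} i∉S rewrite ∉⇒lookup≡false S i i∉S = refl

  masked-*ˡ : ∀ a f i → masked S (λ j → a * f j) i ≡ a * masked S f i
  masked-*ˡ a f i with lookup S i
  ... | true  = refl
  ... | false = sym (ℚ.*-zeroʳ a)

  sumOver-cong : ∀ {f g} → (∀ i → i ∈ S → f i ≡ g i) → sumOver S f ≡ sumOver S g
  sumOver-cong {f} {g} f≗g = sumℚ-cong n λ i → case i
    where
    case : ∀ i → masked S f i ≡ masked S g i
    case i with i ∈? S
    ... | yes i∈S = trans (masked-∈ f i∈S) (trans (f≗g i i∈S) (sym (masked-∈ g i∈S)))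
    ... | no i∉S  = trans (masked-∉ f i∉S) (sym (masked-∉ g i∉S))

  sumOver-zero : ∀ {f} → (∀ i → i ∈ S → f i ≡ 0ℚ) → sumOver S f ≡ 0ℚ
  sumOver-zero {f} f≗0 = sumℚ-zero n λ i → case i
    where
    case : ∀ i → masked S f i ≡ 0ℚ
    case i with i ∈? S
    ... | yes i∈S = trans (masked-∈ f i∈S) (f≗0 i i∈S)
    ... | no i∉S  = masked-∉ f i∉S

  sumOver≡sumℚ : ∀ {f} → Supported S f → sumOver S f ≡ sumℚ n f
  sumOver≡sumℚ {f} f-supp = sumℚ-cong n λ i → case i
    where
    case : ∀ i → masked S f i ≡ f i
    case i with i ∈? S
    ... | yes i∈S = masked-∈ f i∈S
    ... | no i∉S  = trans (masked-∉ f i∉S) (sym (f-supp i i∉S))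

  sumOver-*ˡ : ∀ a f → sumOver S (λ i → a * f i) ≡ a * sumOver S f
  sumOver-*ˡ a f = trans (sumℚ-cong n (masked-*ˡ a f)) (sumℚ-*ˡ n a (masked S f))

  sumOver-*ʳ : ∀ a f → sumOver S (λ i → f i * a) ≡ sumOver S f * a
  sumOver-*ʳ a f = trans (sumOver-cong (λ i _ → ℚ.*-comm (f i) a)) (trans (sumOver-*ˡ a f) (ℚ.*-comm a _))

  sumOver-δ : ∀ {k} f → k ∈ S → sumOver S (λ k' → δ k k' * f k') ≡ f k
  sumOver-δ {k} f k∈S = trans (sumℚ-cong n (λ k' → masked-*ˡ (δ k k') f k'))
                              (trans (sumℚ-δˡ n k (masked S f)) (masked-∈ f k∈S))

  sumℚ-sumOver-comm : ∀ {p} (F : Fin n → Fin p → ℚ) →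
                      sumℚ p (λ j → sumOver S (λ i → F i j)) ≡ sumOver S (λ i → sumℚ p (F i))
  sumℚ-sumOver-comm {p} F = trans (sumℚ-comm p n _) (sumℚ-cong n masked-sum)
    where
    masked-sum : ∀ i → sumℚ p (λ j → masked S (λ i → F i j) i) ≡ masked S (λ i → sumℚ p (F i)) i
    masked-sum i with lookup S i
    ... | true  = refl
    ... | false = sumℚ-zero p (λ _ → refl)

sumOver-comm : ∀ {m n} (R : Subset m) (U : Subset n) (F : Fin n → Fin m → ℚ) →
               sumOver U (λ i → sumOver R (F i)) ≡ sumOver R (λ k → sumOver U (λ i → F i k))
sumOver-comm {m} {n} R U F = trans (sumℚ-cong n masked-sumOver) (sumℚ-sumOver-comm R (λ k i → masked U (λ i → F i k) i))
  where
  masked-sumOver : ∀ i → masked U (λ i → sumOver R (F i)) i ≡ sumOver R (λ k → masked U (λ i → F i k) i)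
  masked-sumOver i with lookup U i
  ... | true  = refl
  ... | false = sym (sumOver-zero R (λ _ _ → refl))

module _ {m n} (M : Fin m → Fin n → ℚ) (R : Subset m) (U : Subset n) where

  IsLeftInverseOn : (Fin n → Fin m → ℚ) → Set
  IsLeftInverseOn N = ∀ i i' → i ∈ U → i' ∈ U → sumOver R (λ k → N i k * M k i') ≡ δ i i'

  IsRightInverseOn : (Fin n → Fin m → ℚ) → Set
  IsRightInverseOn N = ∀ k k' → k ∈ R → k' ∈ R → sumOver U (λ i → M k i * N i k') ≡ δ k k'

  leftInverse⇒injective : ∀ {N} → IsLeftInverseOn N → InjectiveOn M U R
  leftInverse⇒injective {N} left x (x-supp , x-rows) i with i ∈? U
  ... | no i∉U  = x-supp i i∉U
  ... | yes i∈U = begin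
    x i                                                      ≡⟨ sumℚ-δˡ n i x ⟨
    sumℚ n (λ i' → δ i i' * x i')                            ≡⟨ sumℚ-cong n entry ⟨
    sumℚ n (λ i' → sumOver R (λ k → N i k * M k i') * x i')  ≡⟨ sumℚ-cong n (λ i' → sumOver-*ʳ R (x i') _) ⟨
    sumℚ n (λ i' → sumOver R (λ k → N i k * M k i' * x i'))  ≡⟨ sumℚ-sumOver-comm R (λ k i' → N i k * M k i' * x i') ⟩
    sumOver R (λ k → sumℚ n (λ i' → N i k * M k i' * x i'))  ≡⟨ sumOver-zero R row ⟩
    0ℚ                                                       ∎
    where
    open ≡-Reasoning
    entry : ∀ i' → sumOver R (λ k → N i k * M k i') * x i' ≡ δ i i' * x i'
    entry i' with i' ∈? U
    ... | yes i'∈U = cong (_* x i') (left i i' i∈U i'∈U)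
    ... | no i'∉U  = trans (cong (sumOver R (λ k → N i k * M k i') *_) (x-supp i' i'∉U))
                           (trans (ℚ.*-zeroʳ (sumOver R (λ k → N i k * M k i')))
                                  (sym (trans (cong (δ i i' *_) (x-supp i' i'∉U)) (ℚ.*-zeroʳ (δ i i')))))
    row : ∀ k → k ∈ R → sumℚ n (λ i' → N i k * M k i' * x i') ≡ 0ℚ
    row k k∈R = begin
      sumℚ n (λ i' → N i k * M k i' * x i') ≡⟨ sumℚ-cong n (λ i' → ℚ.*-assoc (N i k) (M k i') (x i')) ⟩
      sumℚ n (λ i' → N i k * (M k i' * x i')) ≡⟨ sumℚ-*ˡ n (N i k) _ ⟩
      N i k * (M ·ᵥ x) k                    ≡⟨ cong (N i k *_) (x-rows k k∈R) ⟩
      N i k * 0ℚ                            ≡⟨ ℚ.*-zeroʳ (N i k) ⟩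
      0ℚ                                    ∎

  rightInverse⇒surjective : ∀ {N} → IsRightInverseOn N → SurjectiveOn M U R
  rightInverse⇒surjective {N} right y = x , (λ i → masked-∉ U (λ i → sumOver R (λ k → N i k * y k))) , x-rows
    where
    x : Fin n → ℚ
    x = masked U (λ i → sumOver R (λ k → N i k * y k))
    x-rows : ∀ k₀ → k₀ ∈ R → (M ·ᵥ x) k₀ ≡ y k₀
    x-rows k₀ k₀∈R = begin
      (M ·ᵥ x) k₀                                                  ≡⟨ sumℚ-cong n (λ i → masked-*ˡ U (M k₀ i) (λ i → sumOver R (λ k → N i k * y k)) i) ⟨
      sumOver U (λ i → M k₀ i * sumOver R (λ k → N i k * y k))     ≡⟨ sumOver-cong U (λ i _ → sumOver-*ˡ R (M k₀ i) (λ k → N i k * y k)) ⟨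
      sumOver U (λ i → sumOver R (λ k → M k₀ i * (N i k * y k)))   ≡⟨ sumOver-comm R U _ ⟩
      sumOver R (λ k → sumOver U (λ i → M k₀ i * (N i k * y k)))   ≡⟨ sumOver-cong R (λ k _ → trans
                                                                         (sumOver-cong U (λ i _ → sym (ℚ.*-assoc (M k₀ i) (N i k) (y k))))
                                                                         (sumOver-*ʳ U (y k) _)) ⟩
      sumOver R (λ k → sumOver U (λ i → M k₀ i * N i k) * y k)     ≡⟨ sumOver-cong R (λ k k∈R → cong (_* y k) (right k₀ k k₀∈R k∈R)) ⟩
      sumOver R (λ k → δ k₀ k * y k)                               ≡⟨ sumOver-δ R y k₀∈R ⟩
      y k₀                                                         ∎
      where open ≡-Reasoning

  preimages-rightInverse : (surj : SurjectiveOn M U R) → IsRightInverseOn (preimages M surj)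
  preimages-rightInverse surj k k' k∈R k'∈R = begin
    sumOver U (λ i → M k i * N i k') ≡⟨ sumOver≡sumℚ U (λ i i∉U → trans (cong (M k i *_) (preimages-supported M surj k' i i∉U))
                                                                         (ℚ.*-zeroʳ (M k i))) ⟩
    (M ·ᵥ (λ i → N i k')) k          ≡⟨ M·preimages M surj k' k k∈R ⟩
    δ k' k                           ≡⟨ δ-sym k' k ⟩
    δ k k'                           ∎
    where
    open ≡-Reasoning
    N : Fin n → Fin m → ℚ
    N = preimages M surj

  -- Column i' of N M - 1 lies in the kernel of M on U × R.
  preimages-leftInverse : InjectiveOn M U R → (surj : SurjectiveOn M U R) → IsLeftInverseOn (preimages M surj)
  preimages-leftInverse inj surj i i' i∈U i'∈U = trans (w≡δ (inj v (v-supp , v-rows) i)) (δ-sym i' i)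
    where
    N : Fin n → Fin m → ℚ
    N = preimages M surj
    w : Fin n → ℚ
    w j = sumOver R (λ k → N j k * M k i')
    v : Fin n → ℚ
    v j = w j - δ i' j
    w≡δ : v i ≡ 0ℚ → w i ≡ δ i' i
    w≡δ vᵢ≡0 = trans (solve 2 (λ a d → a := (a :- d) :+ d) refl (w i) (δ i' i))
                     (trans (cong (_+ δ i' i) vᵢ≡0) (ℚ.+-identityˡ (δ i' i)))
    v-supp : Supported U v
    v-supp j j∉U = trans (cong₂ _-_ (sumOver-zero R (λ k _ → trans (cong (_* M k i') (preimages-supported M surj k j j∉U))
                                                                   (ℚ.*-zeroˡ (M k i'))))
                                    (δ-≢ (λ i'≡j → j∉U (subst (_∈ U) i'≡j i'∈U))))
                         (ℚ.+-inverseʳ 0ℚ)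
    M·w : ∀ k₀ → k₀ ∈ R → (M ·ᵥ w) k₀ ≡ M k₀ i'
    M·w k₀ k₀∈R = begin
      sumℚ n (λ j → M k₀ j * sumOver R (λ k → N j k * M k i'))   ≡⟨ sumℚ-cong n (λ j → sumOver-*ˡ R (M k₀ j) _) ⟨
      sumℚ n (λ j → sumOver R (λ k → M k₀ j * (N j k * M k i'))) ≡⟨ sumℚ-sumOver-comm R (λ k j → M k₀ j * (N j k * M k i')) ⟩
      sumOver R (λ k → sumℚ n (λ j → M k₀ j * (N j k * M k i'))) ≡⟨ sumOver-cong R (λ k _ → trans
                                                                        (sumℚ-cong n (λ j → sym (ℚ.*-assoc (M k₀ j) (N j k) (M k i'))))
                                                                        (sumℚ-*ʳ n (M k i') _)) ⟩
      sumOver R (λ k → (M ·ᵥ (λ j → N j k)) k₀ * M k i')        ≡⟨ sumOver-cong R (λ k _ → cong (_* M k i')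
                                                                        (trans (M·preimages M surj k k₀ k₀∈R) (δ-sym k k₀))) ⟩
      sumOver R (λ k → δ k₀ k * M k i')                          ≡⟨ sumOver-δ R (λ k → M k i') k₀∈R ⟩
      M k₀ i'                                                    ∎
      where open ≡-Reasoning
    v-rows : ∀ k₀ → k₀ ∈ R → (M ·ᵥ v) k₀ ≡ 0ℚ
    v-rows k₀ k₀∈R = trans (·ᵥ-- M w (δ i') k₀)
                           (trans (cong₂ _-_ (M·w k₀ k₀∈R) (·ᵥ-δ M i' k₀)) (ℚ.+-inverseʳ (M k₀ i')))

  bijective⇒inverseOn : InjectiveOn M U R → SurjectiveOn M U R →
                        ∃ λ N → IsLeftInverseOn N × IsRightInverseOn N
  bijective⇒inverseOn inj surj = preimages M surj , preimages-leftInverse inj surj , preimages-rightInverse surj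

injective⇒∣S∣≤∣T∣ : ∀ {m n} (M : Fin m → Fin n → ℚ) {S T} → InjectiveOn M S T → ∣ S ∣ ≤ ∣ T ∣
injective⇒∣S∣≤∣T∣ M {S} {T} inj with ∣ S ∣ ℕ.≤? ∣ T ∣
... | yes ∣S∣≤∣T∣ = ∣S∣≤∣T∣
... | no ∣S∣≰∣T∣ with nonzeroKernelVector M S T (ℕ.≰⇒> ∣S∣≰∣T∣)
...   | x , x-kernel , i , xᵢ≢0 = ⊥-elim (xᵢ≢0 (inj x x-kernel i))

≢0-*-cancelˡ : ∀ a t → a ≢ 0ℚ → a * t ≡ 0ℚ → t ≡ 0ℚ
≢0-*-cancelˡ a t a≢0 at≡0 = begin
  t              ≡⟨ solve 1 (λ t → t := con 1ℚ :* t) refl t ⟩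
  1ℚ * t         ≡⟨ cong (_* t) (ℚ.*-inverseˡ a) ⟨
  1/ a * a * t   ≡⟨ ℚ.*-assoc (1/ a) a t ⟩
  1/ a * (a * t) ≡⟨ cong (1/ a *_) at≡0 ⟩
  1/ a * 0ℚ      ≡⟨ ℚ.*-zeroʳ (1/ a) ⟩
  0ℚ             ∎
  where
  open ≡-Reasoning
  instance
    a-nonZero : NonZero a
    a-nonZero = ≢-nonZero a≢0

column-∈-span⊎independent :
  ∀ {m n} (M : Fin m → Fin n → ℚ) {U R b w} → InjectiveOn M U R → b ∉ U →
  Supported U w → (∀ k → k ∈ R → (M ·ᵥ w) k ≡ M k b) →
  (∀ a → (M ·ᵥ w) a ≡ M a b) ⊎ InjectiveOn M (U ∪ ⁅ b ⁆) ⊤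
column-∈-span⊎independent {n = n} M {U} {R} {b} {w} inj b∉U w-supp w-rows
  with Fin.all? (λ a → (M ·ᵥ w) a ℚ.≟ M a b)
... | yes in-span = inj₁ in-span
... | no not-in-span = inj₂ independent
  where
  independent : InjectiveOn M (U ∪ ⁅ b ⁆) ⊤
  independent c (c-supp , c-rows) = c≡0
    where
    β : ℚ
    β = c b
    c' : Fin n → ℚ
    c' j = c j + β * (w j - δ b j)
    M·c' : ∀ a → (M ·ᵥ c') a ≡ β * ((M ·ᵥ w) a - M a b)
    M·c' a = begin
      (M ·ᵥ c') a                                  ≡⟨ ·ᵥ-+ M c _ a ⟩
      (M ·ᵥ c) a + (M ·ᵥ (λ j → β * (w j - δ b j))) a ≡⟨ cong₂ _+_ (c-rows a ∈⊤) (trans (·ᵥ-* M β _ a)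
                                                           (cong (β *_) (trans (·ᵥ-- M w (δ b) a) (cong (λ t → (M ·ᵥ w) a - t) (·ᵥ-δ M b a))))) ⟩
      0ℚ + β * ((M ·ᵥ w) a - M a b)                 ≡⟨ ℚ.+-identityˡ _ ⟩
      β * ((M ·ᵥ w) a - M a b)                      ∎
      where open ≡-Reasoning
    c'-supp : Supported U c'
    c'-supp j j∉U with j Fin.≟ b
    ... | yes refl = trans (cong₂ (λ u v → β + β * (u - v)) (w-supp b b∉U) (δ-refl b))
                           (solve 1 (λ β → β :+ β :* (con 0ℚ :- con 1ℚ) := con 0ℚ) refl β)
    ... | no j≢b = trans (cong₂ (λ u v → u + β * v) (c-supp j j∉U∪b)
                                (cong₂ _-_ (w-supp j j∉U) (δ-≢ (j≢b ∘ sym))))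
                         (solve 1 (λ β → con 0ℚ :+ β :* (con 0ℚ :- con 0ℚ) := con 0ℚ) refl β)
      where
      j∉U∪b : j ∉ U ∪ ⁅ b ⁆
      j∉U∪b j∈U∪b = [ j∉U , j≢b ∘ x∈⁅y⁆⇒x≡y b ]′ (x∈p∪q⁻ U ⁅ b ⁆ j∈U∪b)
    c'≡0 : ∀ j → c' j ≡ 0ℚ
    c'≡0 = inj c' (c'-supp , λ k k∈R → trans (M·c' k) (trans (cong (λ t → β * (t - M k b)) (w-rows k k∈R))
                                                               (trans (cong (β *_) (ℚ.+-inverseʳ (M k b))) (ℚ.*-zeroʳ β))))
    β≡0 : β ≡ 0ℚ
    β≡0 with β ℚ.≟ 0ℚ
    ... | yes β≡0 = β≡0
    ... | no β≢0 = ⊥-elim (not-in-span λ a →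
                     difference≡0⇒≡ (≢0-*-cancelˡ β _ β≢0 (trans (sym (M·c' a)) (·ᵥ-zero M c'≡0 a))))
      where
      difference≡0⇒≡ : ∀ {u v} → u - v ≡ 0ℚ → u ≡ v
      difference≡0⇒≡ {u} {v} u-v≡0 = trans (solve 2 (λ u v → u := (u :- v) :+ v) refl u v)
                                           (trans (cong (_+ v) u-v≡0) (ℚ.+-identityˡ v))
    c≡0 : ∀ j → c j ≡ 0ℚ
    c≡0 j = trans (solve 3 (λ c β t → c := (c :+ β :* t) :- β :* t) refl (c j) β (w j - δ b j))
                  (trans (cong₂ (λ u v → u - v * (w j - δ b j)) (c'≡0 j) β≡0)
                         (solve 1 (λ t → con 0ℚ :- con 0ℚ :* t := con 0ℚ) refl (w j - δ b j)))

∈-full : ∀ {n} {S : Subset n} {i} → S ≡ ⊤ → i ∈ S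
∈-full refl = ∈⊤

∉-empty : ∀ {n} {S : Subset n} {i} → S ≡ ⊥ → i ∉ S
∉-empty refl = ∉⊥

module _ (X : CWComplex) where

  -- ∂ X j x is boundaryMatrix j ·ᵥ x by definition.
  boundaryMatrix : ∀ j → Fin (ncells X j) → Fin (ncells X (suc j)) → ℚ
  boundaryMatrix j a b = toℚ (bd X j a b)

  ∂∘∂ : ∀ j x k → ∂ X j (∂ X (suc j) x) k ≡ 0ℚ
  ∂∘∂ j x k = trans (·ᵥ-·ᵥ (boundaryMatrix j) (boundaryMatrix (suc j)) x k)
                    (sumℚ-zero _ (λ c → trans (cong (_* x c) (entry c)) (ℚ.*-zeroˡ (x c))))
    where
    entry : ∀ c → (boundaryMatrix j ·ᵥ (λ b → boundaryMatrix (suc j) b c)) k ≡ 0ℚ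
    entry c = begin
      sumℚ _ (λ b → toℚ (bd X j k b) * toℚ (bd X (suc j) b c)) ≡⟨ sumℚ-cong _ (λ b → toℚ-* (bd X j k b) _) ⟨
      sumℚ _ (λ b → toℚ (bd X j k b ℤ.* bd X (suc j) b c)) ≡⟨ toℚ-sum (ncells X (suc j)) (λ b → bd X j k b ℤ.* bd X (suc j) b c) ⟨
      toℚ (sumℤ _ (λ b → bd X j k b ℤ.* bd X (suc j) b c))   ≡⟨ cong toℚ (bd∘bd X j k c) ⟩
      0ℚ ∎
      where open ≡-Reasoning

  chainOf-full : ∀ (A : CellSet X) {j} {x : Chain X j} → A j ≡ ⊤ → ChainOf X A j x
  chainOf-full A A-full i i∉A = ⊥-elim (i∉A (∈-full A-full))

  cycle⇒chain : ∀ (A : CellSet X) j x → IsCycle X A j x → ChainOf X A j x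
  cycle⇒chain A zero    x x-chain           = x-chain
  cycle⇒chain A (suc j) x (x-chain , _)     = x-chain

  boundary-isCycle : ∀ (A : CellSet X) j (y : Chain X (suc j)) → ChainOf X A j (∂ X j y) → IsCycle X A j (∂ X j y)
  boundary-isCycle A zero    y ∂y-chain = ∂y-chain
  boundary-isCycle A (suc j) y ∂y-chain = ∂y-chain , λ i _ → ∂∘∂ j y i

  cycle-full : ∀ (A : CellSet X) j x → A j ≡ ⊤ → IsCycle X (λ _ → ⊤) j x → IsCycle X A j x
  cycle-full A zero    x A-full _             = chainOf-full A A-full
  cycle-full A (suc j) x A-full (_ , ∂x≡0) = chainOf-full A A-full , ∂x≡0

  cycle-minus-boundary : ∀ (A : CellSet X) j (x z : Chain X j) (w : Chain X (suc j)) →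
                         IsCycle X (λ _ → ⊤) j x → ChainOf X A j z →
                         (∀ i → x i ≡ ∂ X j w i + z i) → IsCycle X A j z
  cycle-minus-boundary A zero    x z w _           z-chain _       = z-chain
  cycle-minus-boundary A (suc j) x z w (_ , ∂x≡0) z-chain x≡∂w+z = z-chain , λ i _ → begin
    ∂ X j z i                              ≡⟨ ·ᵥ-cong (boundaryMatrix j) z≡x-∂w i ⟩
    ∂ X j (λ t → x t - ∂ X (suc j) w t) i  ≡⟨ ·ᵥ-- (boundaryMatrix j) x _ i ⟩
    ∂ X j x i - ∂ X j (∂ X (suc j) w) i    ≡⟨ cong₂ _-_ (∂x≡0 i ∉⊥) (∂∘∂ j w i) ⟩
    0ℚ - 0ℚ                                ≡⟨⟩
    0ℚ                                     ∎
    where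
    open ≡-Reasoning
    z≡x-∂w : ∀ t → z t ≡ x t - ∂ X (suc j) w t
    z≡x-∂w t = trans (solve 2 (λ z d → z := (d :+ z) :- d) refl (z t) (∂ X (suc j) w t))
                     (cong (_- ∂ X (suc j) w t) (sym (x≡∂w+z t)))

  relCycle-full : ∀ (A B : CellSet X) j x → A j ≡ ⊤ → (∀ k → suc k ≡ j → B k ≡ ⊤) → IsRelCycle X A B j x
  relCycle-full A B zero    x A-full _      = chainOf-full A A-full
  relCycle-full A B (suc j) x A-full B-full = chainOf-full A A-full , chainOf-full B (B-full j refl)

  image⊆span : ∀ {m n} {M : Fin m → Fin n → ℚ} {U} → ColsBasis X M U →
               ∀ y → ∃ λ w → Supported U w × (∀ a → (M ·ᵥ w) a ≡ (M ·ᵥ y) a)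
  image⊆span {n = n} {M} (_ , span) y = C ·ᵥ y , C·y-supp , M·C·y
    where
    C : Fin n → Fin n → ℚ
    C j b = proj₁ (span b) j
    C·y-supp : Supported _ (C ·ᵥ y)
    C·y-supp j j∉U = sumℚ-zero n (λ b → trans (cong (_* y b) (proj₁ (proj₂ (span b)) j j∉U)) (ℚ.*-zeroˡ (y b)))
    M·C·y : ∀ a → (M ·ᵥ (C ·ᵥ y)) a ≡ (M ·ᵥ y) a
    M·C·y a = trans (·ᵥ-·ᵥ M C y a) (sumℚ-cong n (λ b → cong (_* y b) (sym (proj₂ (proj₂ (span b)) a))))

module Main (Sg : CWComplex) (r : ℕ) (Υ Γ : CellSet Sg)
  (rank : HasRank Sg (topMatrix Sg) r)
  (Υ-sub : IsSubcomplex Sg Υ) (Γ-sub : IsSubcomplex Sg Γ)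
  (Γ-above : ∀ j → suc (dim Sg) ≤ j → Γ j ≡ ⊥)
  (∣Υ-top∣ : ∣ Υ (suc (dim Sg)) ∣ ≡ r)
  (∣Γ-top∣ : ∣ Γ (dim Sg) ∣ ≡ ncells Sg (dim Sg) ∸ r)
  (Υ-skeleton : ∀ j → j ≤ dim Sg → Υ j ≡ ⊤)
  (Γ-skeleton : ∀ j → j < dim Sg → Γ j ≡ ⊤) where

  d : ℕ
  d = dim Sg

  M : Fin (ncells Sg d) → Fin (ncells Sg (suc d)) → ℚ
  M = topMatrix Sg

  U : Subset (ncells Sg (suc d))
  U = Υ (suc d)

  R : Subset (ncells Sg d)
  R = ∁ (Γ d)

  injective⇒colsIndependent : ∀ {S} → InjectiveOn M S ⊤ → ColsIndependent Sg M S
  injective⇒colsIndependent inj c c-supp c-rows = inj c (c-supp , λ a _ → c-rows a)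

  colsIndependent⇒injective : ∀ {S} → ColsIndependent Sg M S → InjectiveOn M S ⊤
  colsIndependent⇒injective independent c (c-supp , c-rows) = independent c c-supp (λ a → c-rows a ∈⊤)

  ∣R∣≡∣U∣ : ∣ R ∣ ≡ ∣ U ∣
  ∣R∣≡∣U∣ = begin
    ∣ R ∣           ≡⟨ ∣∁p∣≡n∸∣p∣ (Γ d) ⟩
    m ∸ ∣ Γ d ∣     ≡⟨ cong (m ∸_) ∣Γ-top∣ ⟩
    m ∸ (m ∸ r)     ≡⟨ ℕ.m∸[m∸n]≡n r≤m ⟩
    r               ≡⟨ ∣Υ-top∣ ⟨
    ∣ U ∣           ∎
    where
    open ≡-Reasoning
    m : ℕ
    m = ncells Sg d
    r≤m : r ≤ m
    r≤m with proj₁ rank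
    ... | S , ∣S∣≡r , independent =
      subst₂ _≤_ ∣S∣≡r (∣⊤∣≡n m) (injective⇒∣S∣≤∣T∣ M (colsIndependent⇒injective independent))

  nonsingular⇔injective : NonsingularSub Sg M R U ⇔ InjectiveOn M U R
  nonsingular⇔injective = mk⇔
    (λ (N , left , _) → leftInverse⇒injective M R U {N} left)
    (λ inj → bijective⇒inverseOn M R U inj (injective⇒surjective M (ℕ.≤-reflexive ∣R∣≡∣U∣) inj))

  nonsingular⇔surjective : NonsingularSub Sg M R U ⇔ SurjectiveOn M U R
  nonsingular⇔surjective = mk⇔
    (λ (N , _ , right) → rightInverse⇒surjective M R U {N} right)
    (λ surj → bijective⇒inverseOn M R U (surjective⇒injective M (ℕ.≤-reflexive (sym ∣R∣≡∣U∣)) surj) surj)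

  Γ-top-empty : ∀ {i} → i ∉ Γ (suc d)
  Γ-top-empty = ∉-empty (Γ-above (suc d) ℕ.≤-refl)

  H̃d-vanishes⇔injective : RelHomologyVanishes Sg Υ Γ (suc d) ⇔ InjectiveOn M U R
  H̃d-vanishes⇔injective = mk⇔ to from
    where
    to : RelHomologyVanishes Sg Υ Γ (suc d) → InjectiveOn M U R
    to vanishes x (x-supp , x-rows) i with vanishes x (x-supp , λ k k∉Γ → x-rows k (x∉p⇒x∈∁p k∉Γ))
    ... | y , z , _ , z-chain , x≡∂y+z = trans (x≡∂y+z i)
      (cong₂ _+_ (sumℚ-empty (finite-dim Sg (suc (suc d)) ℕ.≤-refl) _) (z-chain i Γ-top-empty))
    from : InjectiveOn M U R → RelHomologyVanishes Sg Υ Γ (suc d)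
    from inj x (x-supp , ∂x-chain) = (λ _ → 0ℚ) , (λ _ → 0ℚ) , (λ _ _ → refl) , (λ _ _ → refl) , λ i → trans
      (inj x (x-supp , λ k k∈R → ∂x-chain k (x∈∁p⇒x∉p k∈R)) i)
      (sym (cong (_+ 0ℚ) (·ᵥ-zero (boundaryMatrix Sg (suc d)) (λ _ → refl) i)))

  every-chain-relCycle : ∀ j → j ≡ d → ∀ x → IsRelCycle Sg Υ Γ j x
  every-chain-relCycle j refl x =
    relCycle-full Sg Υ Γ j x (Υ-skeleton j ℕ.≤-refl) (λ k 1+k≡j → Γ-skeleton k (ℕ.≤-reflexive 1+k≡j))

  H̃d-1-vanishes⇔surjective : RelHomologyVanishes Sg Υ Γ d ⇔ SurjectiveOn M U R
  H̃d-1-vanishes⇔surjective = mk⇔ to from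
    where
    to : RelHomologyVanishes Sg Υ Γ d → SurjectiveOn M U R
    to vanishes b with vanishes b (every-chain-relCycle d refl b)
    ... | y , z , y-chain , z-chain , b≡∂y+z = y , y-chain , λ k k∈R → sym (trans (b≡∂y+z k)
      (trans (cong (∂ Sg d y k +_) (z-chain k (x∈∁p⇒x∉p k∈R))) (ℚ.+-identityʳ _)))
    from : SurjectiveOn M U R → RelHomologyVanishes Sg Υ Γ d
    from surj x _ with surj x
    ... | y , y-supp , y-rows = y , (λ k → x k - ∂ Sg d y k) , y-supp , z-chain ,
                                λ i → solve 2 (λ x u → x := u :+ (x :- u)) refl (x i) (∂ Sg d y i)
      where
      z-chain : ChainOf Sg Γ d (λ k → x k - ∂ Sg d y k)
      z-chain k k∉Γ = trans (cong (_- ∂ Sg d y k) (sym (y-rows k (x∉p⇒x∈∁p k∉Γ)))) (ℚ.+-inverseʳ (∂ Sg d y k))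

  forest×acyclic⇒injective : IsCellularSpanningForest Sg Υ × IsRelativelyAcyclic Sg Γ → InjectiveOn M U R
  forest×acyclic⇒injective ((_ , _ , independent , _) , (_ , _ , _ , acyclic)) x (x-supp , x-rows) =
    independent x x-supp ∂x≡0
    where
    ∂x-chain : ChainOf Sg Γ d (∂ Sg d x)
    ∂x-chain k k∉Γ = x-rows k (x∉p⇒x∈∁p k∉Γ)
    ∂x≡0 : ∀ a → (M ·ᵥ x) a ≡ 0ℚ
    ∂x≡0 a with proj₁ (acyclic d ℕ.≤-refl) (∂ Sg d x) (boundary-isCycle Sg Γ d x ∂x-chain) (x , λ _ → refl)
    ... | y , y-chain , ∂x≡∂y = trans (∂x≡∂y a) (·ᵥ-zero M (λ j → y-chain j Γ-top-empty) a)

  module _ (inj : InjectiveOn M U R) where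

    abstract
      surj : SurjectiveOn M U R
      surj = injective⇒surjective M (ℕ.≤-reflexive ∣R∣≡∣U∣) inj

      -- A column outside U that is not in the span of U would give r + 1 independent columns.
      colsBasis : ColsBasis Sg M U
      colsBasis = injective⇒colsIndependent (λ c (c-supp , c-rows) → inj c (c-supp , λ k _ → c-rows k ∈⊤)) , span
        where
        span : ∀ b → ∃ λ c → Supported U c × (∀ a → M a b ≡ (M ·ᵥ c) a)
        span b with b ∈? U
        ... | yes b∈U = δ b , δ-supported b∈U , λ a → sym (·ᵥ-δ M b a)
        ... | no b∉U with surj (λ k → M k b)
        ...   | w , w-supp , w-rows with column-∈-span⊎independent M inj b∉U w-supp w-rows
        ...     | inj₁ in-span     = w , w-supp , λ a → sym (in-span a)
        ...     | inj₂ independent = ⊥-elim (proj₂ rank (U ∪ ⁅ b ⁆) (trans (∣p∪⁅x⁆∣≡1+∣p∣ b∉U) (cong suc ∣Υ-top∣))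
                                                       (injective⇒colsIndependent independent))

      H̃d-1-vanishes : RelHomologyVanishes Sg Υ Γ d
      H̃d-1-vanishes = Equivalence.from H̃d-1-vanishes⇔surjective surj

    spanningForest : IsCellularSpanningForest Sg Υ
    spanningForest = Υ-sub , Υ-skeleton , colsBasis

    -- A d-1 cycle of Γ bounding in Σ is M w with w supported on U, and w = 0 by injectivity.
    inclInjective-top : InclInjective Sg Γ d
    inclInjective-top x x-cycle (y , x≡∂y) with image⊆span Sg colsBasis y
    ... | w , w-supp , Mw≡My =
      (λ _ → 0ℚ) , (λ _ _ → refl) , λ i → trans (x≡0 i) (sym (·ᵥ-zero (boundaryMatrix Sg d) (λ _ → refl) i))
      where
      Mw≡x : ∀ k → (M ·ᵥ w) k ≡ x k
      Mw≡x k = trans (Mw≡My k) (sym (x≡∂y k))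
      w≡0 : ∀ j → w j ≡ 0ℚ
      w≡0 = inj w (w-supp , λ k k∈R → trans (Mw≡x k) (cycle⇒chain Sg Γ d x x-cycle k (x∈∁p⇒x∉p k∈R)))
      x≡0 : ∀ k → x k ≡ 0ℚ
      x≡0 k = trans (sym (Mw≡x k)) (·ᵥ-zero M w≡0 k)

    inclSurjective-top : InclSurjective Sg Γ d
    inclSurjective-top x x-cycle with H̃d-1-vanishes x (every-chain-relCycle d refl x)
    ... | y , z , _ , z-chain , x≡∂y+z =
      z , y , cycle-minus-boundary Sg Γ d x z y x-cycle z-chain x≡∂y+z , λ i → trans (x≡∂y+z i) (ℚ.+-comm _ (z i))

    inclInjective-codim1 : ∀ j → suc j ≡ d → InclInjective Sg Γ j
    inclInjective-codim1 j 1+j≡d x _ (y , x≡∂y)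
      with subst (RelHomologyVanishes Sg Υ Γ) (sym 1+j≡d) H̃d-1-vanishes y (every-chain-relCycle (suc j) 1+j≡d y)
    ... | w , z , _ , z-chain , y≡∂w+z = z , z-chain , λ i → begin
      x i                                      ≡⟨ x≡∂y i ⟩
      ∂ Sg j y i                               ≡⟨ ·ᵥ-cong (boundaryMatrix Sg j) y≡∂w+z i ⟩
      ∂ Sg j (λ t → ∂ Sg (suc j) w t + z t) i  ≡⟨ ·ᵥ-+ (boundaryMatrix Sg j) _ z i ⟩
      ∂ Sg j (∂ Sg (suc j) w) i + ∂ Sg j z i   ≡⟨ cong (_+ ∂ Sg j z i) (∂∘∂ Sg j w i) ⟩
      0ℚ + ∂ Sg j z i                          ≡⟨ ℚ.+-identityˡ _ ⟩
      ∂ Sg j z i                               ∎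
      where open ≡-Reasoning

    inclInjective-below : ∀ j → j < d → InclInjective Sg Γ j
    inclInjective-below j j<d with ℕ.m≤n⇒m<n∨m≡n j<d
    ... | inj₁ 1+j<d = λ x _ (y , x≡∂y) → y , chainOf-full Sg Γ (Γ-skeleton (suc j) 1+j<d) , x≡∂y
    ... | inj₂ 1+j≡d = inclInjective-codim1 j 1+j≡d

    inclSurjective-below : ∀ j → j < d → InclSurjective Sg Γ j
    inclSurjective-below j j<d x x-cycle = x , (λ _ → 0ℚ) , cycle-full Sg Γ j x (Γ-skeleton j j<d) x-cycle ,
      λ i → sym (trans (cong (x i +_) (·ᵥ-zero (boundaryMatrix Sg j) (λ _ → refl) i)) (ℚ.+-identityʳ (x i)))

    relativelyAcyclic : IsRelativelyAcyclic Sg Γ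
    relativelyAcyclic = Γ-sub , Γ-above , Γ-skeleton , acyclic
      where
      acyclic : ∀ j → j ≤ d → InclInjective Sg Γ j × InclSurjective Sg Γ j
      acyclic j j≤d with ℕ.m≤n⇒m<n∨m≡n j≤d
      ... | inj₁ j<d = inclInjective-below j j<d , inclSurjective-below j j<d
      ... | inj₂ refl = inclInjective-top , inclSurjective-top

  injective⇔forest×acyclic : InjectiveOn M U R ⇔ (IsCellularSpanningForest Sg Υ × IsRelativelyAcyclic Sg Γ)
  injective⇔forest×acyclic = mk⇔ (λ inj → spanningForest inj , relativelyAcyclic inj) forest×acyclic⇒injective

proposition3p2 :
  (Sg : CWComplex) (r : ℕ) (Υ Γ : CellSet Sg) →
  HasRank Sg (topMatrix Sg) r →
  IsSubcomplex Sg Υ → IsSubcomplex Sg Γ → _⊆ᶜ_ Sg Γ Υ →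
  (∀ j → suc (dim Sg) ≤ j → Γ j ≡ ⊥) →
  ∣ Υ (suc (dim Sg)) ∣ ≡ r →
  ∣ Γ (dim Sg) ∣ ≡ ncells Sg (dim Sg) ∸ r →
  (∀ j → j ≤ dim Sg → Υ j ≡ ⊤) →
  (∀ j → j < dim Sg → Γ j ≡ ⊤) →
  let R = ∁ (Γ (dim Sg))
      A = NonsingularSub Sg (topMatrix Sg) R (Υ (suc (dim Sg)))
      B = RelHomologyVanishes Sg Υ Γ (suc (dim Sg))
          × RelHomologyVanishes Sg Υ Γ (dim Sg)
      C = RelHomologyVanishes Sg Υ Γ (suc (dim Sg))
          ⊎ RelHomologyVanishes Sg Υ Γ (dim Sg)
      D = IsCellularSpanningForest Sg Υ × IsRelativelyAcyclic Sg Γ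
  in (A ⇔ B) × (A ⇔ C) × (A ⇔ D)
proposition3p2 Sg r Υ Γ rank Υ-sub Γ-sub _ Γ-above ∣Υ-top∣ ∣Γ-top∣ Υ-skeleton Γ-skeleton =
    mk⇔ (λ a → to A⇔H̃d a , to A⇔H̃d-1 a) (from A⇔H̃d ∘ proj₁)
  , mk⇔ (inj₁ ∘ to A⇔H̃d) [ from A⇔H̃d , from A⇔H̃d-1 ]′
  , injective⇔forest×acyclic ⇔-∘ nonsingular⇔injective
  where
  open Main Sg r Υ Γ rank Υ-sub Γ-sub Γ-above ∣Υ-top∣ ∣Γ-top∣ Υ-skeleton Γ-skeleton
  open Equivalence
  A⇔H̃d : NonsingularSub Sg M R U ⇔ RelHomologyVanishes Sg Υ Γ (suc d)
  A⇔H̃d = ⇔-sym H̃d-vanishes⇔injective ⇔-∘ nonsingular⇔injective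
  A⇔H̃d-1 : NonsingularSub Sg M R U ⇔ RelHomologyVanishes Sg Υ Γ d
  A⇔H̃d-1 = ⇔-sym H̃d-1-vanishes⇔surjective ⇔-∘ nonsingular⇔surjective
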